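{- Let $(\alpha_n)_{n\ge0}$ be a sequence of complex numbers, $A_n(x)=\sum_{\nu=0}^{n}\binom{n}{\nu}\alpha_{n-\nu}x^\nu$, and assume $A_m(1-x)=(-1)^mA_m(x)$ for all $m\ge0$. For each $n\ge0$ let $F_n(u)=\sum_{k\ge0}h_{n,k}\frac{u^k}{k!}$ be the polynomial with $A_n(x)=(2x-1)^{\delta_n}F_n(x(x-1))$. Then, with $F_n'$, $F_n''$ denoting derivatives with respect to $u$: $$nF_{n-1}(u)=\begin{cases}F_n'(u),& n\ge2\text{ even},\\ 2F_n(u)+(4u+1)F_n'(u),& n\ge1\text{ odd},\end{cases}$$ $$n(n-1)F_{n-2}(u)=\begin{cases}2F_n'(u)+(4u+1)F_n''(u),& n\ge2\text{ even},\\ 6F_n'(u)+(4u+1)F_n''(u),& n\ge3\text{ odd}.\end{cases}$$ For the coefficients, for $0\le k\le d_{n-1}$, $$n\,h_{n-1,k}=\begin{cases}h_{n,k+1},& n\ge2\text{ even},\\ (4k+2)h_{n,k}+h_{n,k+1},& n\ge1\text{ odd},\end{cases}$$ and for $0\le k\le d_{n-2}$, $$n(n-1)\,h_{n-2,k}=\begin{cases}(4k+2)h_{n,k+1}+h_{n,k+2},& n\ge2\text{ even},\\ (4k+6)h_{n,k+1}+h_{n,k+2},& n\ge3\text{ odd}.\end{cases}$$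
   Context: $\alpha_0=0$ is allowed. $d_m=\lfloor m/2\rfloor$; $\delta_m=1$ if $m$ is odd and $0$ otherwise. Under the reflection assumption, for each $m\ge0$ there is a unique polynomial $F_m$ with $A_m(x)=(2x-1)^{\delta_m}F_m(x(x-1))$; it has degree at most $d_m$, and $h_{m,k}=0$ for $k>d_m$. -}

module Defs where

open import Level using (_⊔_)
open import Algebra.Bundles using (CommutativeRing)
open import Data.Nat using (ℕ; zero; suc; _∸_; _≤_)
open import Data.Nat.DivMod using (_/_; _%_)
open import Data.Nat.Combinatorics using (_C_)
open import Data.List using (List; []; _∷_)
open import Data.Sum using (_⊎_)
open import Relation.Nullary using (¬_)

d : ℕ → ℕ
d m = m / 2

δ : ℕ → ℕ
δ m = m % 2

module Over {c ℓ} (R : CommutativeRing c ℓ) where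
  open CommutativeRing R

  nat : ℕ → Carrier
  nat zero = 0#
  nat (suc n) = 1# + nat n

  pow : Carrier → ℕ → Carrier
  pow x zero = 1#
  pow x (suc n) = x * pow x n

  sumTo : ℕ → (ℕ → Carrier) → Carrier
  sumTo zero f = f 0
  sumTo (suc n) f = sumTo n f + f (suc n)

  A : (ℕ → Carrier) → ℕ → Carrier → Carrier
  A α n x = sumTo n (λ ν → nat (n C ν) * (α (n ∸ ν) * pow x ν))

  -- polynomials as coefficient lists, lowest degree first
  Poly : Set c
  Poly = List Carrier

  eval : Poly → Carrier → Carrier
  eval [] u = 0#
  eval (a ∷ as) u = a + u * eval as u

  coeff : Poly → ℕ → Carrier
  coeff [] k = 0#
  coeff (a ∷ as) zero = a
  coeff (a ∷ as) (suc k) = coeff as k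

  derivFrom : ℕ → Poly → Poly
  derivFrom k [] = []
  derivFrom k (b ∷ bs) = (nat k * b) ∷ derivFrom (suc k) bs

  deriv : Poly → Poly
  deriv [] = []
  deriv (a ∷ as) = derivFrom 1 as

  factorial : ℕ → ℕ
  factorial zero = 1
  factorial (suc n) = suc n Data.Nat.* factorial n

  -- h_{n,k} for F_n(u) = Σ_k h_{n,k} u^k / k!, i.e. h = k! · [u^k] F_n
  h : (ℕ → Poly) → ℕ → ℕ → Carrier
  h F n k = nat (factorial k) * coeff (F n) k

  IsIntegralDomain : Set (c ⊔ ℓ)
  IsIntegralDomain = ∀ a b → a * b ≈ 0# → a ≈ 0# ⊎ b ≈ 0#

  CharZero : Set ℓ
  CharZero = ∀ n → ¬ (nat (suc n) ≈ 0#)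

module Submission where

open import Algebra.Bundles using (CommutativeRing)
open import Algebra.Solver.Ring.AlmostCommutativeRing
  using (fromCommutativeRing; _-Raw-AlmostCommutative⟶_)
open import Data.Empty using (⊥-elim)
open import Data.Integer as ℤ using (ℤ; +_; -[1+_]; _⊖_; _◃_)
import Data.Integer.Properties as ℤP
open import Data.List using ([]; _∷_; length; applyUpTo)
open import Data.Maybe using (Maybe; just; nothing)
import Data.Nat as N
open import Data.Nat using (ℕ; zero; suc; _∸_; _≤_; _<_; z≤n; s≤s)
import Data.Nat.Properties as NP
open import Data.Nat.Combinatorics using (_C_; nC1≡n; nCk+nC[k+1]≡[n+1]C[k+1])
open import Data.Nat.Combinatorics.Specification using (k>n⇒nCk≡0)
open import Data.Nat.Tactic.RingSolver using (solve-∀)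
open import Data.Product using (_×_; _,_; ∃-syntax)
import Data.Sign as Sign
open import Data.Sum using (inj₁; inj₂)
open import Relation.Nullary using (¬_; yes; no)
open import Relation.Binary.PropositionalEquality as ≡ using (_≡_)

open import Defs

-- Since A_n is an Appell sequence, A_n′ = n A_{n-1}. Put u = x(x-1), so du/dx = 2x-1 and
-- (2x-1)² = 4u+1. Differentiating A_n(x) = (2x-1)^{δ_n} F_n(u) by the chain rule and comparing
-- with n A_{n-1}(x) = n (2x-1)^{δ_{n-1}} F_{n-1}(u) gives (2x-1) F_n′(u) = n (2x-1) F_{n-1}(u) for
-- even n and 2 F_n(u) + (4u+1) F_n′(u) = n F_{n-1}(u) for odd n. Over an integral domain of
-- characteristic zero, identities holding at the infinitely many points u = j(j+1) (where
-- 2x-1 ≠ 0) are identities of polynomials. Reading off coefficients in the basis u^k/k! gives the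
-- first-order recurrences for h; since n and n-1 have opposite parities, applying them twice gives
-- the second-order recurrences, which lift back to polynomials because k! ≠ 0.

δ[1+m]≡0⇒δ[m]≡1 : ∀ m → δ (suc m) ≡ 0 → δ m ≡ 1
δ[1+m]≡0⇒δ[m]≡1 zero ()
δ[1+m]≡0⇒δ[m]≡1 (suc zero) _ = ≡.refl
δ[1+m]≡0⇒δ[m]≡1 (suc (suc m)) e = δ[1+m]≡0⇒δ[m]≡1 m e

δ[1+m]≡1⇒δ[m]≡0 : ∀ m → δ (suc m) ≡ 1 → δ m ≡ 0
δ[1+m]≡1⇒δ[m]≡0 zero _ = ≡.refl
δ[1+m]≡1⇒δ[m]≡0 (suc zero) ()
δ[1+m]≡1⇒δ[m]≡0 (suc (suc m)) e = δ[1+m]≡1⇒δ[m]≡0 m e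

[1+k]*[1+n]C[1+k]≡[1+n]*nCk : ∀ n k → suc k N.* (suc n C suc k) ≡ suc n N.* (n C k)
[1+k]*[1+n]C[1+k]≡[1+n]*nCk zero zero = ≡.refl
[1+k]*[1+n]C[1+k]≡[1+n]*nCk zero (suc k)
  rewrite k>n⇒nCk≡0 {1} {suc (suc k)} (s≤s (s≤s z≤n)) | k>n⇒nCk≡0 {0} {suc k} (s≤s z≤n)
  = NP.*-zeroʳ (suc (suc k))
[1+k]*[1+n]C[1+k]≡[1+n]*nCk (suc n) zero
  rewrite nC1≡n (2 N.+ n) = ≡.trans (NP.+-identityʳ _) (≡.sym (NP.*-identityʳ _))
[1+k]*[1+n]C[1+k]≡[1+n]*nCk (suc n) (suc k) = begin
  suc (suc k) N.* (suc (suc n) C suc (suc k))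
    ≡⟨ ≡.cong (suc (suc k) N.*_) (nCk+nC[k+1]≡[n+1]C[k+1] (suc n) (suc k)) ⟨
  suc (suc k) N.* (X N.+ Y)
    ≡⟨ distribute k X Y ⟩
  X N.+ ((suc k N.* X) N.+ suc (suc k) N.* Y)
    ≡⟨ ≡.cong₂ (λ a b → X N.+ (a N.+ b))
         ([1+k]*[1+n]C[1+k]≡[1+n]*nCk n k) ([1+k]*[1+n]C[1+k]≡[1+n]*nCk n (suc k)) ⟩
  X N.+ (suc n N.* (n C k) N.+ suc n N.* (n C suc k))
    ≡⟨ ≡.cong (X N.+_) (NP.*-distribˡ-+ (suc n) (n C k) (n C suc k)) ⟨
  X N.+ suc n N.* (n C k N.+ n C suc k)
    ≡⟨ ≡.cong (λ z → X N.+ suc n N.* z) (nCk+nC[k+1]≡[n+1]C[k+1] n k) ⟩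
  X N.+ suc n N.* X ∎
  where
  open ≡.≡-Reasoning
  X = suc n C suc k
  Y = suc n C suc (suc k)
  distribute : ∀ k x y → suc (suc k) N.* (x N.+ y) ≡ x N.+ (suc k N.* x N.+ suc (suc k) N.* y)
  distribute = solve-∀

module Polynomials {c ℓ} (R : CommutativeRing c ℓ) where
  open CommutativeRing R
  open Over R
  open import Algebra.Properties.Ring ring
    using ( -‿distribˡ-*; -‿distribʳ-*; -0#≈0#; -‿involutive; -‿+-comm; -1*x≈-x
          ; x∙y⁻¹≈ε⇒x≈y; x≈y⇒x∙y⁻¹≈ε; x[y-z]≈xy-xz )
  open import Algebra.Properties.CommutativeSemigroup +-commutativeSemigroup
    using () renaming (interchange to +-interchange)
  open import Algebra.Properties.CommutativeSemigroup *-commutativeSemigroup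
    using () renaming (x∙yz≈y∙xz to *-leftSwap)
  open import Relation.Binary.Reasoning.Setoid setoid

  nat-+ : ∀ m n → nat (m N.+ n) ≈ nat m + nat n
  nat-+ zero n = sym (+-identityˡ _)
  nat-+ (suc m) n = trans (+-congˡ (nat-+ m n)) (sym (+-assoc _ _ _))

  nat-* : ∀ m n → nat (m N.* n) ≈ nat m * nat n
  nat-* zero n = sym (zeroˡ _)
  nat-* (suc m) n = begin
    nat (n N.+ m N.* n)         ≈⟨ nat-+ n (m N.* n) ⟩
    nat n + nat (m N.* n)       ≈⟨ +-cong (sym (*-identityˡ _)) (nat-* m n) ⟩
    1# * nat n + nat m * nat n  ≈⟨ distribʳ _ _ _ ⟨
    (1# + nat m) * nat n        ∎

  -- Integer coefficients for the ring solver

  fromℤ : ℤ → Carrier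
  fromℤ (+ n)      = nat n
  fromℤ -[1+ n ]   = - nat (suc n)

  fromℤ-⊖ : ∀ m n → fromℤ (m ⊖ n) ≈ nat m - nat n
  fromℤ-⊖ m zero = begin
    fromℤ (m ⊖ 0)  ≡⟨ ≡.cong fromℤ (ℤP.⊖-≥ {m} z≤n) ⟩
    nat m          ≈⟨ +-identityʳ (nat m) ⟨
    nat m + 0#     ≈⟨ +-congˡ -0#≈0# ⟨
    nat m - 0#     ∎
  fromℤ-⊖ zero (suc n) = sym (+-identityˡ _)
  fromℤ-⊖ (suc m) (suc n) = begin
    fromℤ (suc m ⊖ suc n)           ≡⟨ ≡.cong fromℤ (ℤP.[1+m]⊖[1+n]≡m⊖n m n) ⟩
    fromℤ (m ⊖ n)                   ≈⟨ fromℤ-⊖ m n ⟩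
    nat m - nat n                   ≈⟨ +-identityˡ _ ⟨
    0# + (nat m - nat n)            ≈⟨ +-congʳ (-‿inverseʳ 1#) ⟨
    (1# - 1#) + (nat m - nat n)     ≈⟨ +-interchange 1# (- 1#) (nat m) (- nat n) ⟩
    (1# + nat m) + (- 1# - nat n)   ≈⟨ +-congˡ (-‿+-comm 1# (nat n)) ⟩
    (1# + nat m) - (1# + nat n)     ∎

  fromℤ-+ : ∀ i j → fromℤ (i ℤ.+ j) ≈ fromℤ i + fromℤ j
  fromℤ-+ (+ m)    (+ n)    = nat-+ m n
  fromℤ-+ (+ m)    -[1+ n ] = fromℤ-⊖ m (suc n)
  fromℤ-+ -[1+ m ] (+ n)    = trans (fromℤ-⊖ n (suc m)) (+-comm _ _)
  fromℤ-+ -[1+ m ] -[1+ n ] = begin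
    - nat (suc (suc (m N.+ n)))      ≡⟨ ≡.cong (λ k → - nat k) (NP.+-suc (suc m) n) ⟨
    - nat (suc m N.+ suc n)          ≈⟨ -‿cong (nat-+ (suc m) (suc n)) ⟩
    - (nat (suc m) + nat (suc n))    ≈⟨ -‿+-comm _ _ ⟨
    - nat (suc m) + - nat (suc n)    ∎

  fromℤ-pos◃ : ∀ n → fromℤ (Sign.+ ◃ n) ≈ nat n
  fromℤ-pos◃ zero    = refl
  fromℤ-pos◃ (suc n) = refl

  fromℤ-neg◃ : ∀ n → fromℤ (Sign.- ◃ n) ≈ - nat n
  fromℤ-neg◃ zero    = sym -0#≈0#
  fromℤ-neg◃ (suc n) = refl

  fromℤ-* : ∀ i j → fromℤ (i ℤ.* j) ≈ fromℤ i * fromℤ j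
  fromℤ-* (+ m) (+ n) = trans (fromℤ-pos◃ (m N.* n)) (nat-* m n)
  fromℤ-* (+ m) -[1+ n ] = begin
    fromℤ (Sign.- ◃ m N.* suc n)  ≈⟨ fromℤ-neg◃ (m N.* suc n) ⟩
    - nat (m N.* suc n)           ≈⟨ -‿cong (nat-* m (suc n)) ⟩
    - (nat m * nat (suc n))       ≈⟨ -‿distribʳ-* _ _ ⟩
    nat m * - nat (suc n)         ∎
  fromℤ-* -[1+ m ] (+ n) = begin
    fromℤ (Sign.- ◃ suc m N.* n)  ≈⟨ fromℤ-neg◃ (suc m N.* n) ⟩
    - nat (suc m N.* n)           ≈⟨ -‿cong (nat-* (suc m) n) ⟩
    - (nat (suc m) * nat n)       ≈⟨ -‿distribˡ-* _ _ ⟩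
    - nat (suc m) * nat n         ∎
  fromℤ-* -[1+ m ] -[1+ n ] = begin
    nat (suc m N.* suc n)            ≈⟨ nat-* (suc m) (suc n) ⟩
    nat (suc m) * nat (suc n)        ≈⟨ -‿involutive _ ⟨
    - - (nat (suc m) * nat (suc n))  ≈⟨ -‿cong (-‿distribʳ-* _ _) ⟩
    - (nat (suc m) * - nat (suc n))  ≈⟨ -‿distribˡ-* _ _ ⟩
    - nat (suc m) * - nat (suc n)    ∎

  fromℤ-neg : ∀ i → fromℤ (ℤ.- i) ≈ - fromℤ i
  fromℤ-neg (+ zero)  = sym -0#≈0#
  fromℤ-neg (+ suc n) = refl
  fromℤ-neg -[1+ n ]  = sym (-‿involutive _)

  -- The solver's constants are built with ι rather than nat so that con (+ 0), con (+ 1)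
  -- and con (+ n) reduce to 0#, 1# and nat n exactly as these occur in goals.
  ι : ℕ → Carrier
  ι zero              = 0#
  ι (suc zero)        = 1#
  ι n@(suc (suc _))   = nat n

  ⟦_⟧ : ℤ → Carrier
  ⟦ + n ⟧      = ι n
  ⟦ -[1+ n ] ⟧ = - ι (suc n)

  ⟦⟧≈fromℤ : ∀ i → ⟦ i ⟧ ≈ fromℤ i
  ⟦⟧≈fromℤ (+ zero)          = refl
  ⟦⟧≈fromℤ (+ suc zero)      = sym (+-identityʳ 1#)
  ⟦⟧≈fromℤ (+ suc (suc n))   = refl
  ⟦⟧≈fromℤ -[1+ zero ]       = -‿cong (sym (+-identityʳ 1#))
  ⟦⟧≈fromℤ -[1+ suc n ]      = refl

  ℤ⟶R : ℤ.+-*-rawRing -Raw-AlmostCommutative⟶ fromCommutativeRing R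
  ℤ⟶R = record
    { ⟦_⟧    = ⟦_⟧
    ; +-homo = λ i j → via (i ℤ.+ j) (fromℤ-+ i j) (+-cong (⟦⟧≈fromℤ i) (⟦⟧≈fromℤ j))
    ; *-homo = λ i j → via (i ℤ.* j) (fromℤ-* i j) (*-cong (⟦⟧≈fromℤ i) (⟦⟧≈fromℤ j))
    ; -‿homo = λ i → via (ℤ.- i) (fromℤ-neg i) (-‿cong (⟦⟧≈fromℤ i))
    ; 0-homo = refl
    ; 1-homo = refl
    }
    where
    via : ∀ i {x y} → fromℤ i ≈ x → y ≈ x → ⟦ i ⟧ ≈ y
    via i p q = trans (⟦⟧≈fromℤ i) (trans p (sym q))

  ⟦⟧-weaklyDecidable : ∀ i j → Maybe (⟦ i ⟧ ≈ ⟦ j ⟧)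
  ⟦⟧-weaklyDecidable i j with i ℤP.≟ j
  ... | yes i≡j = just (reflexive (≡.cong ⟦_⟧ i≡j))
  ... | no _    = nothing

  open import Algebra.Solver.Ring ℤ.+-*-rawRing (fromCommutativeRing R) ℤ⟶R ⟦⟧-weaklyDecidable
    using (solve; _:=_; _:+_; _:*_; _:-_; :-_; con)

  -- Polynomial arithmetic and derivatives

  infixl 6 _+ₚ_
  infixl 7 _*ₚ_
  infixr 7 _·ₚ_

  _+ₚ_ : Poly → Poly → Poly
  []      +ₚ q       = q
  (a ∷ p) +ₚ []      = a ∷ p
  (a ∷ p) +ₚ (b ∷ q) = a + b ∷ p +ₚ q

  _·ₚ_ : Carrier → Poly → Poly
  a ·ₚ []      = []
  a ·ₚ (b ∷ p) = a * b ∷ a ·ₚ p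

  _*ₚ_ : Poly → Poly → Poly
  []      *ₚ q = []
  (a ∷ p) *ₚ q = a ·ₚ q +ₚ (0# ∷ p *ₚ q)

  _∘ₚ_ : Poly → Poly → Poly
  []      ∘ₚ g = []
  (a ∷ p) ∘ₚ g = (a ∷ []) +ₚ g *ₚ (p ∘ₚ g)

  eval-cong : ∀ p {x y} → x ≈ y → eval p x ≈ eval p y
  eval-cong []      x≈y = refl
  eval-cong (a ∷ p) x≈y = +-congˡ (*-cong x≈y (eval-cong p x≈y))

  eval-+ₚ : ∀ p q x → eval (p +ₚ q) x ≈ eval p x + eval q x
  eval-+ₚ []      q       x = sym (+-identityˡ _)
  eval-+ₚ (a ∷ p) []      x = sym (+-identityʳ _)
  eval-+ₚ (a ∷ p) (b ∷ q) x = begin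
    (a + b) + x * eval (p +ₚ q) x             ≈⟨ +-congˡ (*-congˡ (eval-+ₚ p q x)) ⟩
    (a + b) + x * (eval p x + eval q x)       ≈⟨ +-congˡ (distribˡ x _ _) ⟩
    (a + b) + (x * eval p x + x * eval q x)   ≈⟨ +-interchange a b _ _ ⟩
    (a + x * eval p x) + (b + x * eval q x)   ∎

  eval-·ₚ : ∀ a p x → eval (a ·ₚ p) x ≈ a * eval p x
  eval-·ₚ a []      x = sym (zeroʳ a)
  eval-·ₚ a (b ∷ p) x = begin
    a * b + x * eval (a ·ₚ p) x   ≈⟨ +-congˡ (*-congˡ (eval-·ₚ a p x)) ⟩
    a * b + x * (a * eval p x)    ≈⟨ +-congˡ (*-leftSwap x a _) ⟩
    a * b + a * (x * eval p x)    ≈⟨ distribˡ a b _ ⟨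
    a * (b + x * eval p x)        ∎

  eval-*ₚ : ∀ p q x → eval (p *ₚ q) x ≈ eval p x * eval q x
  eval-*ₚ []      q x = sym (zeroˡ _)
  eval-*ₚ (a ∷ p) q x = begin
    eval (a ·ₚ q +ₚ (0# ∷ p *ₚ q)) x          ≈⟨ eval-+ₚ (a ·ₚ q) (0# ∷ p *ₚ q) x ⟩
    eval (a ·ₚ q) x + (0# + x * eval (p *ₚ q) x)
      ≈⟨ +-cong (eval-·ₚ a q x) (+-congˡ (*-congˡ (eval-*ₚ p q x))) ⟩
    a * Q + (0# + x * (P * Q))
      ≈⟨ solve 4 (λ a x P Q → a :* Q :+ (con (+ 0) :+ x :* (P :* Q)) := (a :+ x :* P) :* Q)
           refl a x P Q ⟩
    (a + x * P) * Q                            ∎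
    where P = eval p x; Q = eval q x

  eval-∘ₚ : ∀ p g x → eval (p ∘ₚ g) x ≈ eval p (eval g x)
  eval-∘ₚ []      g x = refl
  eval-∘ₚ (a ∷ p) g x = begin
    eval ((a ∷ []) +ₚ g *ₚ (p ∘ₚ g)) x
      ≈⟨ eval-+ₚ (a ∷ []) (g *ₚ (p ∘ₚ g)) x ⟩
    (a + x * 0#) + eval (g *ₚ (p ∘ₚ g)) x
      ≈⟨ +-cong (trans (+-congˡ (zeroʳ x)) (+-identityʳ a)) (eval-*ₚ g (p ∘ₚ g) x) ⟩
    a + eval g x * eval (p ∘ₚ g) x            ≈⟨ +-congˡ (*-congˡ (eval-∘ₚ p g x)) ⟩
    a + eval g x * eval p (eval g x)          ∎

  eval-derivFrom-suc : ∀ k p x → eval (derivFrom (suc k) p) x ≈ eval (derivFrom k p) x + eval p x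
  eval-derivFrom-suc k []      x = sym (+-identityʳ _)
  eval-derivFrom-suc k (b ∷ p) x = begin
    (1# + nat k) * b + x * eval (derivFrom (suc (suc k)) p) x
      ≈⟨ +-congˡ (*-congˡ (eval-derivFrom-suc (suc k) p x)) ⟩
    (1# + nat k) * b + x * (E + eval p x)
      ≈⟨ solve 5 (λ n b x E P → (con (+ 1) :+ n) :* b :+ x :* (E :+ P)
                              := (n :* b :+ x :* E) :+ (b :+ x :* P))
           refl (nat k) b x E (eval p x) ⟩
    (nat k * b + x * E) + (b + x * eval p x)   ∎
    where E = eval (derivFrom (suc k) p) x

  eval-deriv-∷ : ∀ a p x → eval (deriv (a ∷ p)) x ≈ eval p x + x * eval (deriv p) x
  eval-deriv-∷ a []      x = sym (trans (+-congˡ (zeroʳ x)) (+-identityʳ 0#))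
  eval-deriv-∷ a (b ∷ p) x = begin
    eval (derivFrom 1 (b ∷ p)) x                       ≈⟨ eval-derivFrom-suc 0 (b ∷ p) x ⟩
    (0# * b + x * eval (derivFrom 1 p) x) + eval (b ∷ p) x
      ≈⟨ +-congʳ (trans (+-congʳ (zeroˡ b)) (+-identityˡ _)) ⟩
    x * eval (deriv (b ∷ p)) x + eval (b ∷ p) x        ≈⟨ +-comm _ _ ⟩
    eval (b ∷ p) x + x * eval (deriv (b ∷ p)) x        ∎

  eval-derivFrom-+ₚ : ∀ k p q x →
    eval (derivFrom k (p +ₚ q)) x ≈ eval (derivFrom k p) x + eval (derivFrom k q) x
  eval-derivFrom-+ₚ k []      q       x = sym (+-identityˡ _)
  eval-derivFrom-+ₚ k (a ∷ p) []      x = sym (+-identityʳ _)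
  eval-derivFrom-+ₚ k (a ∷ p) (b ∷ q) x = begin
    nat k * (a + b) + x * eval (derivFrom (suc k) (p +ₚ q)) x
      ≈⟨ +-cong (distribˡ (nat k) a b) (*-congˡ (eval-derivFrom-+ₚ (suc k) p q x)) ⟩
    (nat k * a + nat k * b) + x * (P + Q)      ≈⟨ +-congˡ (distribˡ x P Q) ⟩
    (nat k * a + nat k * b) + (x * P + x * Q)  ≈⟨ +-interchange _ _ _ _ ⟩
    (nat k * a + x * P) + (nat k * b + x * Q)  ∎
    where P = eval (derivFrom (suc k) p) x; Q = eval (derivFrom (suc k) q) x

  eval-deriv-+ₚ : ∀ p q x → eval (deriv (p +ₚ q)) x ≈ eval (deriv p) x + eval (deriv q) x
  eval-deriv-+ₚ []      q       x = sym (+-identityˡ _)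
  eval-deriv-+ₚ (a ∷ p) []      x = sym (+-identityʳ _)
  eval-deriv-+ₚ (a ∷ p) (b ∷ q) x = eval-derivFrom-+ₚ 1 p q x

  eval-derivFrom-·ₚ : ∀ k a p x → eval (derivFrom k (a ·ₚ p)) x ≈ a * eval (derivFrom k p) x
  eval-derivFrom-·ₚ k a []      x = sym (zeroʳ a)
  eval-derivFrom-·ₚ k a (b ∷ p) x = begin
    nat k * (a * b) + x * eval (derivFrom (suc k) (a ·ₚ p)) x
      ≈⟨ +-cong (*-leftSwap (nat k) a b) (*-congˡ (eval-derivFrom-·ₚ (suc k) a p x)) ⟩
    a * (nat k * b) + x * (a * E)    ≈⟨ +-congˡ (*-leftSwap x a E) ⟩
    a * (nat k * b) + a * (x * E)    ≈⟨ distribˡ a _ _ ⟨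
    a * (nat k * b + x * E)          ∎
    where E = eval (derivFrom (suc k) p) x

  eval-deriv-·ₚ : ∀ a p x → eval (deriv (a ·ₚ p)) x ≈ a * eval (deriv p) x
  eval-deriv-·ₚ a []      x = sym (zeroʳ a)
  eval-deriv-·ₚ a (b ∷ p) x = eval-derivFrom-·ₚ 1 a p x

  eval-deriv-*ₚ : ∀ p q x →
    eval (deriv (p *ₚ q)) x ≈ eval (deriv p) x * eval q x + eval p x * eval (deriv q) x
  eval-deriv-*ₚ []      q x = sym (trans (+-cong (zeroˡ _) (zeroˡ _)) (+-identityˡ 0#))
  eval-deriv-*ₚ (a ∷ p) q x = begin
    eval (deriv (a ·ₚ q +ₚ (0# ∷ p *ₚ q))) x
      ≈⟨ eval-deriv-+ₚ (a ·ₚ q) (0# ∷ p *ₚ q) x ⟩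
    eval (deriv (a ·ₚ q)) x + eval (deriv (0# ∷ p *ₚ q)) x
      ≈⟨ +-cong (eval-deriv-·ₚ a q x) (eval-deriv-∷ 0# (p *ₚ q) x) ⟩
    a * Q′ + (eval (p *ₚ q) x + x * eval (deriv (p *ₚ q)) x)
      ≈⟨ +-congˡ (+-cong (eval-*ₚ p q x) (*-congˡ (eval-deriv-*ₚ p q x))) ⟩
    a * Q′ + (P * Q + x * (P′ * Q + P * Q′))
      ≈⟨ solve 6 (λ a x P P′ Q Q′ → a :* Q′ :+ (P :* Q :+ x :* (P′ :* Q :+ P :* Q′))
                                  := (P :+ x :* P′) :* Q :+ (a :+ x :* P) :* Q′)
           refl a x P P′ Q Q′ ⟩
    (P + x * P′) * Q + (a + x * P) * Q′
      ≈⟨ +-congʳ (*-congʳ (eval-deriv-∷ a p x)) ⟨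
    eval (deriv (a ∷ p)) x * Q + (a + x * P) * Q′  ∎
    where P = eval p x; P′ = eval (deriv p) x; Q = eval q x; Q′ = eval (deriv q) x

  eval-deriv-∘ₚ : ∀ p g x →
    eval (deriv (p ∘ₚ g)) x ≈ eval (deriv p) (eval g x) * eval (deriv g) x
  eval-deriv-∘ₚ []      g x = sym (zeroˡ _)
  eval-deriv-∘ₚ (a ∷ p) g x = begin
    eval (deriv ((a ∷ []) +ₚ g *ₚ (p ∘ₚ g))) x
      ≈⟨ eval-deriv-+ₚ (a ∷ []) (g *ₚ (p ∘ₚ g)) x ⟩
    0# + eval (deriv (g *ₚ (p ∘ₚ g))) x
      ≈⟨ +-congˡ (eval-deriv-*ₚ g (p ∘ₚ g) x) ⟩
    0# + (G′ * eval (p ∘ₚ g) x + G * eval (deriv (p ∘ₚ g)) x)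
      ≈⟨ +-congˡ (+-cong (*-congˡ (eval-∘ₚ p g x)) (*-congˡ (eval-deriv-∘ₚ p g x))) ⟩
    0# + (G′ * eval p G + G * (eval (deriv p) G * G′))
      ≈⟨ solve 4 (λ G G′ P P′ → con (+ 0) :+ (G′ :* P :+ G :* (P′ :* G′))
                             := (P :+ G :* P′) :* G′)
           refl G G′ (eval p G) (eval (deriv p) G) ⟩
    (eval p G + G * eval (deriv p) G) * G′
      ≈⟨ *-congʳ (eval-deriv-∷ a p G) ⟨
    eval (deriv (a ∷ p)) G * G′  ∎
    where G = eval g x; G′ = eval (deriv g) x

  infix 4 _≋_
  record _≋_ (p q : Poly) : Set ℓ where
    constructor coeffwise
    field coeff-≈ : ∀ k → coeff p k ≈ coeff q k
  open _≋_

  ≋-tail : ∀ {a b p q} → (a ∷ p) ≋ (b ∷ q) → p ≋ q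
  ≋-tail (coeffwise e) = coeffwise λ k → e (suc k)

  ≋-sym : ∀ {p q} → p ≋ q → q ≋ p
  ≋-sym (coeffwise e) = coeffwise λ k → sym (e k)

  ≋[]⇒eval≈0 : ∀ {p} → p ≋ [] → ∀ x → eval p x ≈ 0#
  ≋[]⇒eval≈0 {[]}    _             x = refl
  ≋[]⇒eval≈0 {a ∷ p} (coeffwise e) x = begin
    a + x * eval p x
      ≈⟨ +-cong (e 0) (*-congˡ (≋[]⇒eval≈0 {p} (coeffwise λ k → e (suc k)) x)) ⟩
    0# + x * 0#        ≈⟨ trans (+-identityˡ _) (zeroʳ x) ⟩
    0#                 ∎

  ≋⇒eval : ∀ {p q} → p ≋ q → ∀ x → eval p x ≈ eval q x
  ≋⇒eval {[]}    {[]}    _   x = refl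
  ≋⇒eval {[]}    {b ∷ q} p≋q x = sym (≋[]⇒eval≈0 (≋-sym p≋q) x)
  ≋⇒eval {a ∷ p} {[]}    p≋q x = ≋[]⇒eval≈0 p≋q x
  ≋⇒eval {a ∷ p} {b ∷ q} p≋q x =
    +-cong (coeff-≈ p≋q 0) (*-congˡ (≋⇒eval (≋-tail p≋q) x))

  coeff-+ₚ : ∀ p q k → coeff (p +ₚ q) k ≈ coeff p k + coeff q k
  coeff-+ₚ []      q       k       = sym (+-identityˡ _)
  coeff-+ₚ (a ∷ p) []      zero    = sym (+-identityʳ _)
  coeff-+ₚ (a ∷ p) []      (suc k) = sym (+-identityʳ _)
  coeff-+ₚ (a ∷ p) (b ∷ q) zero    = refl
  coeff-+ₚ (a ∷ p) (b ∷ q) (suc k) = coeff-+ₚ p q k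

  coeff-·ₚ : ∀ a p k → coeff (a ·ₚ p) k ≈ a * coeff p k
  coeff-·ₚ a []      k       = sym (zeroʳ a)
  coeff-·ₚ a (b ∷ p) zero    = refl
  coeff-·ₚ a (b ∷ p) (suc k) = coeff-·ₚ a p k

  coeff-derivFrom : ∀ m p k → coeff (derivFrom m p) k ≈ nat (m N.+ k) * coeff p k
  coeff-derivFrom m []      k       = sym (zeroʳ _)
  coeff-derivFrom m (b ∷ p) zero    = *-congʳ (reflexive (≡.cong nat (≡.sym (NP.+-identityʳ m))))
  coeff-derivFrom m (b ∷ p) (suc k) =
    trans (coeff-derivFrom (suc m) p k) (*-congʳ (reflexive (≡.cong nat (≡.sym (NP.+-suc m k)))))

  coeff-deriv : ∀ p k → coeff (deriv p) k ≈ nat (suc k) * coeff p (suc k)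
  coeff-deriv []      k = sym (zeroʳ _)
  coeff-deriv (a ∷ p) k = coeff-derivFrom 1 p k

  deriv-cong : ∀ {p q} → p ≋ q → deriv p ≋ deriv q
  deriv-cong {p} {q} (coeffwise e) = coeffwise λ k →
    trans (coeff-deriv p k) (trans (*-congˡ (e (suc k))) (sym (coeff-deriv q k)))

  -- h F n k of the statement unfolds to expCoeff (F n) k.
  expCoeff : Poly → ℕ → Carrier
  expCoeff p k = nat (factorial k) * coeff p k

  expCoeff-+ₚ : ∀ p q k → expCoeff (p +ₚ q) k ≈ expCoeff p k + expCoeff q k
  expCoeff-+ₚ p q k = trans (*-congˡ (coeff-+ₚ p q k)) (distribˡ _ _ _)

  expCoeff-·ₚ : ∀ a p k → expCoeff (a ·ₚ p) k ≈ a * expCoeff p k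
  expCoeff-·ₚ a p k = trans (*-congˡ (coeff-·ₚ a p k)) (*-leftSwap _ a _)

  expCoeff-deriv : ∀ p k → expCoeff (deriv p) k ≈ expCoeff p (suc k)
  expCoeff-deriv p k = begin
    nat (factorial k) * coeff (deriv p) k                 ≈⟨ *-congˡ (coeff-deriv p k) ⟩
    nat (factorial k) * (nat (suc k) * coeff p (suc k))   ≈⟨ *-assoc _ _ _ ⟨
    (nat (factorial k) * nat (suc k)) * coeff p (suc k)   ≈⟨ *-congʳ (*-comm _ _) ⟩
    (nat (suc k) * nat (factorial k)) * coeff p (suc k)   ≈⟨ *-congʳ (nat-* (suc k) (factorial k)) ⟨
    nat (factorial (suc k)) * coeff p (suc k)             ∎

  expCoeff-X*deriv : ∀ p k → expCoeff (0# ∷ deriv p) k ≈ nat k * expCoeff p k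
  expCoeff-X*deriv p zero    = trans (zeroʳ _) (sym (zeroˡ _))
  expCoeff-X*deriv p (suc k) = begin
    nat (factorial (suc k)) * coeff (deriv p) k              ≈⟨ *-congʳ (nat-* (suc k) (factorial k)) ⟩
    (nat (suc k) * nat (factorial k)) * coeff (deriv p) k    ≈⟨ *-assoc _ _ _ ⟩
    nat (suc k) * expCoeff (deriv p) k                       ≈⟨ *-congˡ (expCoeff-deriv p k) ⟩
    nat (suc k) * expCoeff p (suc k)                         ∎

  Θ : ℕ → Poly → Poly
  Θ j p = nat j ·ₚ p +ₚ (nat 4 ·ₚ (0# ∷ deriv p) +ₚ deriv p)

  eval-Θ : ∀ j p u → eval (Θ j p) u ≈ (nat j * eval p u) + (((nat 4 * u) + 1#) * eval (deriv p) u)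
  eval-Θ j p u = begin
    eval (Θ j p) u
      ≈⟨ eval-+ₚ (nat j ·ₚ p) _ u ⟩
    eval (nat j ·ₚ p) u + eval (nat 4 ·ₚ (0# ∷ deriv p) +ₚ deriv p) u
      ≈⟨ +-cong (eval-·ₚ (nat j) p u) (eval-+ₚ (nat 4 ·ₚ (0# ∷ deriv p)) (deriv p) u) ⟩
    nat j * eval p u + (eval (nat 4 ·ₚ (0# ∷ deriv p)) u + P′)
      ≈⟨ +-congˡ (+-congʳ (eval-·ₚ (nat 4) (0# ∷ deriv p) u)) ⟩
    nat j * eval p u + (nat 4 * (0# + u * P′) + P′)
      ≈⟨ +-congˡ (solve 2 (λ u P′ → con (+ 4) :* (con (+ 0) :+ u :* P′) :+ P′
                                 := (con (+ 4) :* u :+ con (+ 1)) :* P′) refl u P′) ⟩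
    nat j * eval p u + (nat 4 * u + 1#) * P′   ∎
    where P′ = eval (deriv p) u

  expCoeff-Θ : ∀ j p k → expCoeff (Θ j p) k ≈ nat (4 N.* k N.+ j) * expCoeff p k + expCoeff p (suc k)
  expCoeff-Θ j p k = begin
    expCoeff (Θ j p) k
      ≈⟨ expCoeff-+ₚ (nat j ·ₚ p) _ k ⟩
    expCoeff (nat j ·ₚ p) k + expCoeff (nat 4 ·ₚ (0# ∷ deriv p) +ₚ deriv p) k
      ≈⟨ +-cong (expCoeff-·ₚ (nat j) p k)
                (expCoeff-+ₚ (nat 4 ·ₚ (0# ∷ deriv p)) (deriv p) k) ⟩
    nat j * e + (expCoeff (nat 4 ·ₚ (0# ∷ deriv p)) k + expCoeff (deriv p) k)
      ≈⟨ +-congˡ (+-cong (trans (expCoeff-·ₚ (nat 4) (0# ∷ deriv p) k)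
                                (*-congˡ (expCoeff-X*deriv p k)))
                         (expCoeff-deriv p k)) ⟩
    nat j * e + (nat 4 * (nat k * e) + e′)
      ≈⟨ solve 4 (λ j k e e′ → j :* e :+ (con (+ 4) :* (k :* e) :+ e′)
                            := (con (+ 4) :* k :+ j) :* e :+ e′)
           refl (nat j) (nat k) e e′ ⟩
    (nat 4 * nat k + nat j) * e + e′
      ≈⟨ +-congʳ (*-congʳ (trans (nat-+ (4 N.* k) j) (+-congʳ (nat-* 4 k)))) ⟨
    nat (4 N.* k N.+ j) * e + e′   ∎
    where e = expCoeff p k; e′ = expCoeff p (suc k)

  expCoeff-Θ-deriv : ∀ j p k →
    expCoeff (Θ j (deriv p)) k ≈ nat (4 N.* k N.+ j) * expCoeff p (suc k) + expCoeff p (suc (suc k))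
  expCoeff-Θ-deriv j p k =
    trans (expCoeff-Θ j (deriv p) k) (+-cong (*-congˡ (expCoeff-deriv p k)) (expCoeff-deriv p (suc k)))

  ≋⇒expCoeff : ∀ {p q} → p ≋ q → ∀ k → expCoeff p k ≈ expCoeff q k
  ≋⇒expCoeff (coeffwise e) k = *-congˡ (e k)

  ·ₚ≋⇒eval : ∀ {a p q} → a ·ₚ p ≋ q → ∀ u → a * eval p u ≈ eval q u
  ·ₚ≋⇒eval {a} {p} e u = trans (sym (eval-·ₚ a p u)) (≋⇒eval e u)

  ·ₚ≋⇒expCoeff : ∀ {a p q} → a ·ₚ p ≋ q → ∀ k → a * expCoeff p k ≈ expCoeff q k
  ·ₚ≋⇒expCoeff {a} {p} e k = trans (sym (expCoeff-·ₚ a p k)) (≋⇒expCoeff e k)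

  -- The Appell polynomials and the substitution u = x(x-1)

  sumTo-cong : ∀ n {f g : ℕ → Carrier} → (∀ ν → f ν ≈ g ν) → sumTo n f ≈ sumTo n g
  sumTo-cong zero    f≈g = f≈g 0
  sumTo-cong (suc n) f≈g = +-cong (sumTo-cong n f≈g) (f≈g (suc n))

  *-distribˡ-sumTo : ∀ n x (f : ℕ → Carrier) → x * sumTo n f ≈ sumTo n (λ ν → x * f ν)
  *-distribˡ-sumTo zero    x f = refl
  *-distribˡ-sumTo (suc n) x f = trans (distribˡ _ _ _) (+-congʳ (*-distribˡ-sumTo n x f))

  sumTo-suc : ∀ n (f : ℕ → Carrier) → sumTo (suc n) f ≈ f 0 + sumTo n (λ ν → f (suc ν))
  sumTo-suc zero    f = refl
  sumTo-suc (suc n) f = trans (+-congʳ (sumTo-suc n f)) (+-assoc _ _ _)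

  eval-applyUpTo : ∀ f n x → eval (applyUpTo f (suc n)) x ≈ sumTo n (λ ν → f ν * pow x ν)
  eval-applyUpTo f zero    x = trans (+-congˡ (zeroʳ x)) (trans (+-identityʳ _) (sym (*-identityʳ _)))
  eval-applyUpTo f (suc n) x = begin
    f 0 + x * eval (applyUpTo (λ ν → f (suc ν)) (suc n)) x
      ≈⟨ +-congˡ (*-congˡ (eval-applyUpTo (λ ν → f (suc ν)) n x)) ⟩
    f 0 + x * sumTo n (λ ν → f (suc ν) * pow x ν)
      ≈⟨ +-cong (sym (*-identityʳ _)) (*-distribˡ-sumTo n x _) ⟩
    f 0 * 1# + sumTo n (λ ν → x * (f (suc ν) * pow x ν))
      ≈⟨ +-congˡ (sumTo-cong n (λ ν → *-leftSwap x (f (suc ν)) _)) ⟩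
    f 0 * 1# + sumTo n (λ ν → f (suc ν) * (x * pow x ν))
      ≈⟨ sumTo-suc n (λ ν → f ν * pow x ν) ⟨
    sumTo (suc n) (λ ν → f ν * pow x ν)   ∎

  coeff-applyUpTo : ∀ f m → (∀ {k} → m ≤ k → f k ≈ 0#) →
                    ∀ k → coeff (applyUpTo f m) k ≈ f k
  coeff-applyUpTo f zero    f≈0 k       = sym (f≈0 z≤n)
  coeff-applyUpTo f (suc m) f≈0 zero    = refl
  coeff-applyUpTo f (suc m) f≈0 (suc k) =
    coeff-applyUpTo (λ ν → f (suc ν)) m (λ m≤k → f≈0 (s≤s m≤k)) k

  Apoly : (ℕ → Carrier) → ℕ → Poly
  Apoly α n = applyUpTo (λ ν → nat (n C ν) * α (n ∸ ν)) (suc n)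

  eval-Apoly : ∀ α n x → eval (Apoly α n) x ≈ A α n x
  eval-Apoly α n x = trans (eval-applyUpTo _ n x) (sumTo-cong n (λ ν → *-assoc _ _ _))

  coeff-Apoly : ∀ α n k → coeff (Apoly α n) k ≈ nat (n C k) * α (n ∸ k)
  coeff-Apoly α n = coeff-applyUpTo _ (suc n) λ n<k →
    trans (*-congʳ (reflexive (≡.cong nat (k>n⇒nCk≡0 n<k)))) (zeroˡ _)

  deriv-Apoly : ∀ α m → deriv (Apoly α (suc m)) ≋ nat (suc m) ·ₚ Apoly α m
  deriv-Apoly α m = coeffwise λ k → begin
    coeff (deriv (Apoly α (suc m))) k                  ≈⟨ coeff-deriv (Apoly α (suc m)) k ⟩
    nat (suc k) * coeff (Apoly α (suc m)) (suc k)      ≈⟨ *-congˡ (coeff-Apoly α (suc m) (suc k)) ⟩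
    nat (suc k) * (nat (suc m C suc k) * α (m ∸ k))    ≈⟨ *-assoc _ _ _ ⟨
    (nat (suc k) * nat (suc m C suc k)) * α (m ∸ k)    ≈⟨ *-congʳ (nat-* (suc k) (suc m C suc k)) ⟨
    nat (suc k N.* (suc m C suc k)) * α (m ∸ k)
      ≡⟨ ≡.cong (λ t → nat t * α (m ∸ k)) ([1+k]*[1+n]C[1+k]≡[1+n]*nCk m k) ⟩
    nat (suc m N.* (m C k)) * α (m ∸ k)                ≈⟨ *-congʳ (nat-* (suc m) (m C k)) ⟩
    (nat (suc m) * nat (m C k)) * α (m ∸ k)            ≈⟨ *-assoc _ _ _ ⟩
    nat (suc m) * (nat (m C k) * α (m ∸ k))            ≈⟨ *-congˡ (coeff-Apoly α m k) ⟨
    nat (suc m) * coeff (Apoly α m) k                  ≈⟨ coeff-·ₚ (nat (suc m)) (Apoly α m) k ⟨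
    coeff (nat (suc m) ·ₚ Apoly α m) k                 ∎

  U : Poly
  U = 0# ∷ - 1# ∷ 1# ∷ []

  eval-U : ∀ x → eval U x ≈ x * (x - 1#)
  eval-U x = solve 1 (λ x → con (+ 0) :+ x :* (:- con (+ 1) :+ x :* (con (+ 1) :+ x :* con (+ 0)))
                          := x :* (x :- con (+ 1))) refl x

  eval-deriv-U : ∀ x → eval (deriv U) x ≈ nat 2 * x - 1#
  eval-deriv-U x = solve 1 (λ x → (con (+ 1) :+ con (+ 0)) :* (:- con (+ 1))
                                  :+ x :* (con (+ 2) :* con (+ 1) :+ x :* con (+ 0))
                              := con (+ 2) :* x :- con (+ 1)) refl x

  eval-deriv²-U : ∀ x → eval (deriv (deriv U)) x ≈ nat 2
  eval-deriv²-U x = solve 1 (λ x → (con (+ 1) :+ con (+ 0)) :* (con (+ 2) :* con (+ 1)) :+ x :* con (+ 0)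
                               := con (+ 2)) refl x

  [2x-1]²≈4x[x-1]+1 : ∀ x → (nat 2 * x - 1#) * (nat 2 * x - 1#) ≈ nat 4 * (x * (x - 1#)) + 1#
  [2x-1]²≈4x[x-1]+1 = solve 1 (λ x → (con (+ 2) :* x :- con (+ 1)) :* (con (+ 2) :* x :- con (+ 1))
                                  := con (+ 4) :* (x :* (x :- con (+ 1))) :+ con (+ 1)) refl

  eval-∘ₚU : ∀ p x → eval (p ∘ₚ U) x ≈ eval p (x * (x - 1#))
  eval-∘ₚU p x = trans (eval-∘ₚ p U x) (eval-cong p (eval-U x))

  eval-deriv-∘ₚU : ∀ p x →
    eval (deriv (p ∘ₚ U)) x ≈ eval (deriv p) (x * (x - 1#)) * (nat 2 * x - 1#)
  eval-deriv-∘ₚU p x =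
    trans (eval-deriv-∘ₚ p U x) (*-cong (eval-cong (deriv p) (eval-U x)) (eval-deriv-U x))

  -- Identity theorem

  ≋[]-head : ∀ {a p} → (a ∷ p) ≋ [] → a ≈ 0#
  ≋[]-head (coeffwise e) = e 0

  ≋[]-tail : ∀ {a p} → (a ∷ p) ≋ [] → p ≋ []
  ≋[]-tail (coeffwise e) = coeffwise λ k → e (suc k)

  ∷-≋[] : ∀ {a p} → a ≈ 0# → p ≋ [] → (a ∷ p) ≋ []
  ∷-≋[] a≈0 (coeffwise e) = coeffwise λ { zero → a≈0 ; (suc k) → e k }

  synthDiv : Carrier → Poly → Poly
  synthDiv r []      = []
  synthDiv r (b ∷ p) = eval (b ∷ p) r ∷ synthDiv r p

  length-synthDiv : ∀ r p → length (synthDiv r p) ≡ length p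
  length-synthDiv r []      = ≡.refl
  length-synthDiv r (b ∷ p) = ≡.cong suc (length-synthDiv r p)

  eval-∷-synthDiv : ∀ a p r x → eval (a ∷ p) x ≈ (x - r) * eval (synthDiv r p) x + eval (a ∷ p) r
  eval-∷-synthDiv a []      r x =
    solve 3 (λ a x r → a :+ x :* con (+ 0) := (x :- r) :* con (+ 0) :+ (a :+ r :* con (+ 0))) refl a x r
  eval-∷-synthDiv a (b ∷ p) r x = begin
    a + x * eval (b ∷ p) x           ≈⟨ +-congˡ (*-congˡ (eval-∷-synthDiv b p r x)) ⟩
    a + x * ((x - r) * Q + B)
      ≈⟨ solve 5 (λ a x r Q B → a :+ x :* ((x :- r) :* Q :+ B)
                              := (x :- r) :* (B :+ x :* Q) :+ (a :+ r :* B))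
           refl a x r Q B ⟩
    (x - r) * (B + x * Q) + (a + r * B)  ∎
    where Q = eval (synthDiv r p) x; B = eval (b ∷ p) r

  root-∷ : ∀ {a p r} → eval (a ∷ p) r ≈ 0# → p ≋ [] → (a ∷ p) ≋ []
  root-∷ {a} {p} {r} root p≋[] = ∷-≋[] a≈0 p≋[]
    where
    a≈0 : a ≈ 0#
    a≈0 = begin
      a                  ≈⟨ +-identityʳ a ⟨
      a + 0#             ≈⟨ +-congˡ (zeroʳ r) ⟨
      a + r * 0#         ≈⟨ +-congˡ (*-congˡ (≋[]⇒eval≈0 p≋[] r)) ⟨
      a + r * eval p r   ≈⟨ root ⟩
      0#                 ∎

  synthDiv≋[]⇒≋[] : ∀ r p → synthDiv r p ≋ [] → p ≋ []
  synthDiv≋[]⇒≋[] r []      _ = coeffwise λ _ → refl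
  synthDiv≋[]⇒≋[] r (b ∷ p) e = root-∷ (≋[]-head e) (synthDiv≋[]⇒≋[] r p (≋[]-tail e))

  Separated : (ℕ → Carrier) → Set ℓ
  Separated pt = ∀ {i j} → i < j → ¬ (pt j - pt i ≈ 0#)

  module _ (cz : CharZero) where

    strictMono⇒Separated : ∀ (g : ℕ → ℕ) → (∀ {i j} → i < j → g i < g j) →
                           Separated (λ i → nat (g i))
    strictMono⇒Separated g mono {i} {j} i<j gj-gi≈0 with NP.m≤n⇒∃[o]m+o≡n (mono i<j)
    ... | o , gi+1+o≡gj = cz o (begin
      nat (suc o)
        ≈⟨ solve 2 (λ a b → b := (a :+ b) :- a) refl (nat (g i)) (nat (suc o)) ⟩
      (nat (g i) + nat (suc o)) - nat (g i)    ≈⟨ +-congʳ (nat-+ (g i) (suc o)) ⟨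
      nat (g i N.+ suc o) - nat (g i)
        ≡⟨ ≡.cong (λ t → nat t - nat (g i)) (≡.trans (NP.+-suc (g i) o) gi+1+o≡gj) ⟩
      nat (g j) - nat (g i)                    ≈⟨ gj-gi≈0 ⟩
      0#                                       ∎)

    factorial≡suc : ∀ k → ∃[ j ] factorial k ≡ suc j
    factorial≡suc zero    = 0 , ≡.refl
    factorial≡suc (suc k) with factorial≡suc k
    ... | j , k!≡1+j = j N.+ k N.* suc j , ≡.cong (suc k N.*_) k!≡1+j

    nat[k!]≉0 : ∀ k → ¬ nat (factorial k) ≈ 0#
    nat[k!]≉0 k with factorial≡suc k
    ... | j , k!≡1+j = λ k!≈0 → cz j (≡.subst (λ t → nat t ≈ 0#) k!≡1+j k!≈0)

  module IntegralDomain (idom : IsIntegralDomain) where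

    *-cancelˡ-≉0 : ∀ {a b c} → ¬ a ≈ 0# → a * b ≈ a * c → b ≈ c
    *-cancelˡ-≉0 {a} {b} {c} a≉0 ab≈ac
      with idom a (b - c) (trans (x[y-z]≈xy-xz a b c) (x≈y⇒x∙y⁻¹≈ε ab≈ac))
    ... | inj₁ a≈0   = ⊥-elim (a≉0 a≈0)
    ... | inj₂ b-c≈0 = x∙y⁻¹≈ε⇒x≈y b c b-c≈0

    vanishing⇒≋[] : ∀ n p pt → Separated pt → length p ≤ n →
                    (∀ i → eval p (pt i) ≈ 0#) → p ≋ []
    vanishing⇒≋[] n       []      pt sep len       vanish = coeffwise λ _ → refl
    vanishing⇒≋[] (suc n) (a ∷ p) pt sep (s≤s len) vanish =
      root-∷ (vanish 0) (synthDiv≋[]⇒≋[] r p quotient≋[])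
      where
      r = pt 0
      quotient-vanishes : ∀ i → eval (synthDiv r p) (pt (suc i)) ≈ 0#
      quotient-vanishes i = *-cancelˡ-≉0 (sep (s≤s z≤n)) (begin
        (pt (suc i) - r) * eval (synthDiv r p) (pt (suc i))
          ≈⟨ trans (+-congˡ (vanish 0)) (+-identityʳ _) ⟨
        (pt (suc i) - r) * eval (synthDiv r p) (pt (suc i)) + eval (a ∷ p) r
          ≈⟨ eval-∷-synthDiv a p r (pt (suc i)) ⟨
        eval (a ∷ p) (pt (suc i))                   ≈⟨ vanish (suc i) ⟩
        0#                                          ≈⟨ zeroʳ _ ⟨
        (pt (suc i) - r) * 0#                       ∎)
      quotient≋[] : synthDiv r p ≋ []
      quotient≋[] = vanishing⇒≋[] n (synthDiv r p) (λ i → pt (suc i)) (λ i<j → sep (s≤s i<j))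
        (≡.subst (_≤ n) (≡.sym (length-synthDiv r p)) len) quotient-vanishes

    agree⇒≋ : ∀ p q pt → Separated pt → (∀ i → eval p (pt i) ≈ eval q (pt i)) → p ≋ q
    agree⇒≋ p q pt sep agree = coeffwise λ k → x∙y⁻¹≈ε⇒x≈y _ _ (begin
      coeff p k - coeff q k                       ≈⟨ difference-coeff k ⟨
      coeff (p +ₚ - 1# ·ₚ q) k                    ≈⟨ coeff-≈ difference≋[] k ⟩
      0#                                          ∎)
      where
      difference-coeff : ∀ k → coeff (p +ₚ - 1# ·ₚ q) k ≈ coeff p k - coeff q k
      difference-coeff k =
        trans (coeff-+ₚ p _ k) (+-congˡ (trans (coeff-·ₚ (- 1#) q k) (-1*x≈-x _)))
      difference≋[] : p +ₚ - 1# ·ₚ q ≋ []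
      difference≋[] = vanishing⇒≋[] _ _ pt sep NP.≤-refl λ i → begin
        eval (p +ₚ - 1# ·ₚ q) (pt i)                ≈⟨ eval-+ₚ p _ (pt i) ⟩
        eval p (pt i) + eval (- 1# ·ₚ q) (pt i)
          ≈⟨ +-cong (agree i) (trans (eval-·ₚ (- 1#) q (pt i)) (-1*x≈-x _)) ⟩
        eval q (pt i) - eval q (pt i)               ≈⟨ -‿inverseʳ _ ⟩
        0#                                          ∎

  module CharZeroDomain (idom : IsIntegralDomain) (cz : CharZero) where
    open IntegralDomain idom

    expCoeff-injective : ∀ {p q} → (∀ k → expCoeff p k ≈ expCoeff q k) → p ≋ q
    expCoeff-injective e = coeffwise λ k → *-cancelˡ-≉0 (nat[k!]≉0 cz k) (e k)

    appell-deriv : ∀ α m G → (∀ x → eval G x ≈ A α (suc m) x) →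
                   ∀ x → eval (deriv G) x ≈ nat (suc m) * A α m x
    appell-deriv α m G G≈A x = begin
      eval (deriv G) x                      ≈⟨ ≋⇒eval (deriv-cong G≋A) x ⟩
      eval (deriv (Apoly α (suc m))) x      ≈⟨ ≋⇒eval (deriv-Apoly α m) x ⟩
      eval (nat (suc m) ·ₚ Apoly α m) x     ≈⟨ eval-·ₚ (nat (suc m)) (Apoly α m) x ⟩
      nat (suc m) * eval (Apoly α m) x      ≈⟨ *-congˡ (eval-Apoly α m x) ⟩
      nat (suc m) * A α m x                 ∎
      where
      G≋A : G ≋ Apoly α (suc m)
      G≋A = agree⇒≋ G _ nat (strictMono⇒Separated cz (λ i → i) (λ i<j → i<j))
              λ i → trans (G≈A (nat i)) (sym (eval-Apoly α (suc m) (nat i)))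

    agreeOnU⇒≋ : ∀ p q →
      (∀ x → ¬ nat 2 * x - 1# ≈ 0# → eval p (x * (x - 1#)) ≈ eval q (x * (x - 1#))) → p ≋ q
    agreeOnU⇒≋ p q agree = agree⇒≋ p q (λ j → nat (suc j N.* j))
      (strictMono⇒Separated cz (λ j → suc j N.* j) (λ i<j → NP.*-mono-< (s≤s i<j) i<j))
      λ j → begin
        eval p (nat (suc j N.* j))            ≈⟨ eval-cong p (x[x-1]≈ j) ⟨
        eval p (x j * (x j - 1#))             ≈⟨ agree (x j) (2x-1≉0 j) ⟩
        eval q (x j * (x j - 1#))             ≈⟨ eval-cong q (x[x-1]≈ j) ⟩
        eval q (nat (suc j N.* j))            ∎
      where
      x : ℕ → Carrier
      x j = nat (suc j)
      x[x-1]≈ : ∀ j → x j * (x j - 1#) ≈ nat (suc j N.* j)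
      x[x-1]≈ j = trans (*-congˡ (solve 1 (λ n → (con (+ 1) :+ n) :- con (+ 1) := n) refl (nat j)))
                        (sym (nat-* (suc j) j))
      2x-1≉0 : ∀ j → ¬ nat 2 * x j - 1# ≈ 0#
      2x-1≉0 j 2x-1≈0 = cz (j N.+ j) (begin
        1# + nat (j N.+ j)      ≈⟨ +-congˡ (nat-+ j j) ⟩
        1# + (nat j + nat j)
          ≈⟨ solve 1 (λ n → con (+ 1) :+ (n :+ n) := con (+ 2) :* (con (+ 1) :+ n) :- con (+ 1))
               refl (nat j) ⟩
        nat 2 * x j - 1#        ≈⟨ 2x-1≈0 ⟩
        0#                      ∎)

  module Recurrences (idom : IsIntegralDomain) (cz : CharZero) (α : ℕ → Carrier) (F : ℕ → Poly)
    (hF : ∀ n x → A α n x ≈ pow ((nat 2 * x) - 1#) (δ n) * eval (F n) (x * (x - 1#))) where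
    open IntegralDomain idom using (*-cancelˡ-≉0)
    open CharZeroDomain idom cz

    A-even : ∀ n → δ n ≡ 0 → ∀ x → A α n x ≈ eval (F n) (x * (x - 1#))
    A-even n δn≡0 x =
      trans (≡.subst (λ e → A α n x ≈ pow (nat 2 * x - 1#) e * Fn) δn≡0 (hF n x)) (*-identityˡ Fn)
      where Fn = eval (F n) (x * (x - 1#))

    A-odd : ∀ n → δ n ≡ 1 → ∀ x → A α n x ≈ (nat 2 * x - 1#) * eval (F n) (x * (x - 1#))
    A-odd n δn≡1 x =
      trans (≡.subst (λ e → A α n x ≈ pow (nat 2 * x - 1#) e * Fn) δn≡1 (hF n x)) (*-congʳ (*-identityʳ _))
      where Fn = eval (F n) (x * (x - 1#))

    firstOrder-even : ∀ n → 2 ≤ n → δ n ≡ 0 → nat n ·ₚ F (n ∸ 1) ≋ deriv (F n)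
    firstOrder-even (suc m) _ δn≡0 = agreeOnU⇒≋ _ _ agree
      where
      n = suc m
      δm≡1 : δ m ≡ 1
      δm≡1 = δ[1+m]≡0⇒δ[m]≡1 m δn≡0
      F∘U≈A : ∀ x → eval (F n ∘ₚ U) x ≈ A α n x
      F∘U≈A x = trans (eval-∘ₚU (F n) x) (sym (A-even n δn≡0 x))
      agree : ∀ x → ¬ nat 2 * x - 1# ≈ 0# →
              eval (nat n ·ₚ F m) (x * (x - 1#)) ≈ eval (deriv (F n)) (x * (x - 1#))
      agree x y≉0 = *-cancelˡ-≉0 y≉0 (begin
        y * eval (nat n ·ₚ F m) u             ≈⟨ *-congˡ (eval-·ₚ (nat n) (F m) u) ⟩
        y * (nat n * eval (F m) u)            ≈⟨ *-leftSwap y (nat n) _ ⟩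
        nat n * (y * eval (F m) u)            ≈⟨ *-congˡ (A-odd m δm≡1 x) ⟨
        nat n * A α m x                       ≈⟨ appell-deriv α m (F n ∘ₚ U) F∘U≈A x ⟨
        eval (deriv (F n ∘ₚ U)) x             ≈⟨ eval-deriv-∘ₚU (F n) x ⟩
        eval (deriv (F n)) u * y              ≈⟨ *-comm _ y ⟩
        y * eval (deriv (F n)) u              ∎)
        where u = x * (x - 1#); y = nat 2 * x - 1#

    firstOrder-odd : ∀ n → 1 ≤ n → δ n ≡ 1 → nat n ·ₚ F (n ∸ 1) ≋ Θ 2 (F n)
    firstOrder-odd (suc m) _ δn≡1 = agreeOnU⇒≋ _ _ agree
      where
      n = suc m
      δm≡0 : δ m ≡ 0
      δm≡0 = δ[1+m]≡1⇒δ[m]≡0 m δn≡1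
      G : Poly
      G = deriv U *ₚ (F n ∘ₚ U)
      G≈A : ∀ x → eval G x ≈ A α n x
      G≈A x = begin
        eval G x                                     ≈⟨ eval-*ₚ (deriv U) (F n ∘ₚ U) x ⟩
        eval (deriv U) x * eval (F n ∘ₚ U) x
          ≈⟨ *-cong (eval-deriv-U x) (eval-∘ₚU (F n) x) ⟩
        (nat 2 * x - 1#) * eval (F n) (x * (x - 1#)) ≈⟨ A-odd n δn≡1 x ⟨
        A α n x                                      ∎
      agree : ∀ x → ¬ nat 2 * x - 1# ≈ 0# →
              eval (nat n ·ₚ F m) (x * (x - 1#)) ≈ eval (Θ 2 (F n)) (x * (x - 1#))
      agree x _ = begin
        eval (nat n ·ₚ F m) u                    ≈⟨ eval-·ₚ (nat n) (F m) u ⟩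
        nat n * eval (F m) u                     ≈⟨ *-congˡ (A-even m δm≡0 x) ⟨
        nat n * A α m x                          ≈⟨ appell-deriv α m G G≈A x ⟨
        eval (deriv G) x                         ≈⟨ eval-deriv-*ₚ (deriv U) (F n ∘ₚ U) x ⟩
        eval (deriv (deriv U)) x * eval (F n ∘ₚ U) x + eval (deriv U) x * eval (deriv (F n ∘ₚ U)) x
          ≈⟨ +-cong (*-cong (eval-deriv²-U x) (eval-∘ₚU (F n) x))
                    (*-cong (eval-deriv-U x) (eval-deriv-∘ₚU (F n) x)) ⟩
        nat 2 * Fn + y * (Fn′ * y)               ≈⟨ +-congˡ (*-leftSwap y Fn′ y) ⟩
        nat 2 * Fn + Fn′ * (y * y)
          ≈⟨ +-congˡ (trans (*-congˡ ([2x-1]²≈4x[x-1]+1 x)) (*-comm _ _)) ⟩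
        nat 2 * Fn + (nat 4 * u + 1#) * Fn′      ≈⟨ eval-Θ 2 (F n) u ⟨
        eval (Θ 2 (F n)) u                       ∎
        where
        u = x * (x - 1#); y = nat 2 * x - 1#; Fn = eval (F n) u; Fn′ = eval (deriv (F n)) u

    h-firstOrder-even : ∀ n → 2 ≤ n → δ n ≡ 0 → ∀ k →
      nat n * h F (n ∸ 1) k ≈ h F n (suc k)
    h-firstOrder-even n le e k =
      trans (·ₚ≋⇒expCoeff (firstOrder-even n le e) k) (expCoeff-deriv (F n) k)

    h-firstOrder-odd : ∀ n → 1 ≤ n → δ n ≡ 1 → ∀ k →
                       nat n * h F (n ∸ 1) k ≈ (nat (4 N.* k N.+ 2) * h F n k) + h F n (suc k)
    h-firstOrder-odd n le e k =
      trans (·ₚ≋⇒expCoeff (firstOrder-odd n le e) k) (expCoeff-Θ 2 (F n) k)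

    h-secondOrder-even : ∀ n → 2 ≤ n → δ n ≡ 0 → ∀ k →
      nat (n N.* (n ∸ 1)) * h F (n ∸ 2) k ≈ (nat (4 N.* k N.+ 2) * h F n (suc k)) + h F n (suc (suc k))
    h-secondOrder-even n@(suc m@(suc l)) le e k = begin
      nat (n N.* m) * h F l k                           ≈⟨ *-congʳ (nat-* n m) ⟩
      (nat n * nat m) * h F l k                         ≈⟨ *-assoc _ _ _ ⟩
      nat n * (nat m * h F l k)
        ≈⟨ *-congˡ (h-firstOrder-odd m (s≤s z≤n) (δ[1+m]≡0⇒δ[m]≡1 m e) k) ⟩
      nat n * (w * h F m k + h F m (suc k))             ≈⟨ distribˡ _ _ _ ⟩
      nat n * (w * h F m k) + nat n * h F m (suc k)     ≈⟨ +-congʳ (*-leftSwap _ w _) ⟩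
      w * (nat n * h F m k) + nat n * h F m (suc k)
        ≈⟨ +-cong (*-congˡ (h-firstOrder-even n le e k)) (h-firstOrder-even n le e (suc k)) ⟩
      w * h F n (suc k) + h F n (suc (suc k))           ∎
      where w = nat (4 N.* k N.+ 2)

    h-secondOrder-odd : ∀ n → 3 ≤ n → δ n ≡ 1 → ∀ k →
      nat (n N.* (n ∸ 1)) * h F (n ∸ 2) k ≈ (nat (4 N.* k N.+ 6) * h F n (suc k)) + h F n (suc (suc k))
    h-secondOrder-odd (suc zero) (s≤s ()) _ _
    h-secondOrder-odd n@(suc m@(suc l)) le e k = begin
      nat (n N.* m) * h F l k                           ≈⟨ *-congʳ (nat-* n m) ⟩
      (nat n * nat m) * h F l k                         ≈⟨ *-assoc _ _ _ ⟩
      nat n * (nat m * h F l k)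
        ≈⟨ *-congˡ (h-firstOrder-even m (NP.≤-pred le) (δ[1+m]≡1⇒δ[m]≡0 m e) k) ⟩
      nat n * h F m (suc k)                             ≈⟨ h-firstOrder-odd n (s≤s z≤n) e (suc k) ⟩
      nat (4 N.* suc k N.+ 2) * h F n (suc k) + h F n (suc (suc k))
        ≡⟨ ≡.cong (λ t → nat t * h F n (suc k) + h F n (suc (suc k))) (4[1+k]+2≡4k+6 k) ⟩
      nat (4 N.* k N.+ 6) * h F n (suc k) + h F n (suc (suc k)) ∎
      where
      4[1+k]+2≡4k+6 : ∀ k → 4 N.* suc k N.+ 2 ≡ 4 N.* k N.+ 6
      4[1+k]+2≡4k+6 = solve-∀

    secondOrder-even : ∀ n → 2 ≤ n → δ n ≡ 0 →
      nat (n N.* (n ∸ 1)) ·ₚ F (n ∸ 2) ≋ Θ 2 (deriv (F n))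
    secondOrder-even n le e = expCoeff-injective λ k →
      trans (expCoeff-·ₚ _ (F (n ∸ 2)) k)
            (trans (h-secondOrder-even n le e k) (sym (expCoeff-Θ-deriv 2 (F n) k)))

    secondOrder-odd : ∀ n → 3 ≤ n → δ n ≡ 1 →
      nat (n N.* (n ∸ 1)) ·ₚ F (n ∸ 2) ≋ Θ 6 (deriv (F n))
    secondOrder-odd n le e = expCoeff-injective λ k →
      trans (expCoeff-·ₚ _ (F (n ∸ 2)) k)
            (trans (h-secondOrder-odd n le e k) (sym (expCoeff-Θ-deriv 6 (F n) k)))

theorem4p6 : ∀ {c ℓ} (R : CommutativeRing c ℓ) →
    let open CommutativeRing R in
    let open Over R in
    IsIntegralDomain → CharZero →
    (α : ℕ → Carrier) →
    (∀ m x → A α m (1# - x) ≈ pow (- 1#) m * A α m x) →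
    (F : ℕ → Poly) →
    (∀ n x → A α n x ≈ pow ((nat 2 * x) - 1#) (δ n) * eval (F n) (x * (x - 1#))) →
    -- first-order identities
    (∀ n → 2 ≤ n → δ n ≡ 0 → ∀ u →
       nat n * eval (F (n ∸ 1)) u ≈ eval (deriv (F n)) u)
    × (∀ n → 1 ≤ n → δ n ≡ 1 → ∀ u →
       nat n * eval (F (n ∸ 1)) u
         ≈ (nat 2 * eval (F n) u) + (((nat 4 * u) + 1#) * eval (deriv (F n)) u))
    -- second-order identities
    × (∀ n → 2 ≤ n → δ n ≡ 0 → ∀ u →
       nat (n N.* (n ∸ 1)) * eval (F (n ∸ 2)) u
         ≈ (nat 2 * eval (deriv (F n)) u)
           + (((nat 4 * u) + 1#) * eval (deriv (deriv (F n))) u))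
    × (∀ n → 3 ≤ n → δ n ≡ 1 → ∀ u →
       nat (n N.* (n ∸ 1)) * eval (F (n ∸ 2)) u
         ≈ (nat 6 * eval (deriv (F n)) u)
           + (((nat 4 * u) + 1#) * eval (deriv (deriv (F n))) u))
    -- coefficient recurrences
    × (∀ n → 2 ≤ n → δ n ≡ 0 → ∀ k → k ≤ d (n ∸ 1) →
       nat n * h F (n ∸ 1) k ≈ h F n (suc k))
    × (∀ n → 1 ≤ n → δ n ≡ 1 → ∀ k → k ≤ d (n ∸ 1) →
       nat n * h F (n ∸ 1) k ≈ (nat (4 N.* k N.+ 2) * h F n k) + h F n (suc k))
    × (∀ n → 2 ≤ n → δ n ≡ 0 → ∀ k → k ≤ d (n ∸ 2) →
       nat (n N.* (n ∸ 1)) * h F (n ∸ 2) k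
         ≈ (nat (4 N.* k N.+ 2) * h F n (suc k)) + h F n (suc (suc k)))
    × (∀ n → 3 ≤ n → δ n ≡ 1 → ∀ k → k ≤ d (n ∸ 2) →
       nat (n N.* (n ∸ 1)) * h F (n ∸ 2) k
         ≈ (nat (4 N.* k N.+ 6) * h F n (suc k)) + h F n (suc (suc k)))
-- The reflection hypothesis only ensures that the F n exist; here they are given.
theorem4p6 R idom cz α _ F hF =
    (λ n le e → ·ₚ≋⇒eval (firstOrder-even n le e))
  , (λ n le e u → trans (·ₚ≋⇒eval (firstOrder-odd n le e) u) (eval-Θ 2 (F n) u))
  , (λ n le e u → trans (·ₚ≋⇒eval (secondOrder-even n le e) u) (eval-Θ 2 (deriv (F n)) u))
  , (λ n le e u → trans (·ₚ≋⇒eval (secondOrder-odd n le e) u) (eval-Θ 6 (deriv (F n)) u))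
  , (λ n le e k _ → h-firstOrder-even n le e k)
  , (λ n le e k _ → h-firstOrder-odd n le e k)
  , (λ n le e k _ → h-secondOrder-even n le e k)
  , (λ n le e k _ → h-secondOrder-odd n le e k)
  where
  open CommutativeRing R using (trans)
  open Over R using (deriv)
  open Polynomials R
  open Recurrences idom cz α F hF
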